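{- Let $G=(V,E)$ be a strongly connected bidirected graph, let $\mathcal{T}$ be a separator decomposition of $G$, let $\pi$ be a nested dissection order induced by $\mathcal{T}$ with $\mathrm{Rank}(v)=\pi^{ -1}(v)$, and let $H$ be the graph obtained by contracting the vertices of $G$ in the order $\pi$. Let $X$ be a node of $\mathcal{T}$, let $G_X$ be the subgraph of $G$ induced by the vertices contained in the subtree $\mathcal{T}_X$, and let $B(X)=\{w\in V\setminus V(G_X) : (v,w)\in E \text{ for some } v\in V(G_X)\}$. Suppose $B(X)\neq\emptyset$ and let $l$ be the lowest-ranked vertex in $B(X)$. Then $S(l)=\bigcup_{b\in B(X)} S(b)$.
   Context: A graph $G=(V,E)$ is bidirected if $(v,w)\in E$ implies $(w,v)\in E$. A separator decomposition of a strongly connected $n$-vertex bidirected graph $G=(V,E)$ is a rooted tree $\mathcal{T}=(\mathcal{X},\mathcal{E})$ whose nodes $X\in\mathcal{X}$ are pairwise disjoint subsets of $V$, defined recursively: if $n=1$, $\mathcal{T}$ is a single node $X=V$; if $n>1$, $\mathcal{T}$ has a root $X\subseteq V$ such that removing $X$ separates $G$ into strongly connected subgraphs $G_0,\dots,G_{d-1}$ (with no edges of $G$ between different $G_i$), and the children of the root are the roots of separator decompositions of $G_0,\dots,G_{d-1}$. For a node $X$, $\mathcal{T}_X$ denotes the subtree rooted at $X$ and $G_X$ the subgraph of $G$ induced by all vertices contained in nodes of $\mathcal{T}_X$. A nested dissection order $\pi$ induced by $\mathcal{T}$ is obtained by numbering the vertices in the order in which they are visited by a postorder walk of $\mathcal{T}$,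 where the vertices within each node are visited in an arbitrary order; $\pi^{ -1}(v)$ is the rank of $v$. Contraction: vertices are processed in increasing rank; to contract a vertex $v$, it is temporarily removed from the current graph and shortcut edges are added between every pair of its remaining (not yet contracted) neighbors. $H$ is the graph consisting of $G$ together with all shortcuts added. The (CCH) search space $S(v)$ of a vertex $v$ is the set of vertices reachable from $v$ in $H$ by paths along which the rank strictly increases (including $v$ itself); equivalently, the set of $v$ and its ancestors in the elimination tree of $H$, in which the parent of $v$ is the lowest-ranked neighbor of $v$ in $H$ with rank higher than $v$. -}

module Defs where

open import Data.Nat using (ℕ; zero; suc; _<_; _≤_)
open import Data.Fin using (Fin; toℕ; fromℕ<)
open import Data.Fin.Subset using (Subset; _∈_; _∉_; _⊆_; ∣_∣; ⁅_⁆)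
open import Data.Fin.Permutation using (Permutation′; _⟨$⟩ʳ_; _⟨$⟩ˡ_)
open import Data.List using (List; []; _∷_; _++_; concat; tabulate)
import Data.List.Membership.Propositional as LM
open import Data.List.Relation.Unary.Unique.Propositional using (Unique)
open import Data.Product using (Σ; ∃; _×_; _,_)
open import Data.Sum using (_⊎_)
open import Function.Bundles using (_⇔_)
open import Relation.Binary.PropositionalEquality using (_≡_; _≢_)
open import Relation.Binary.Construct.Closure.ReflexiveTransitive using (Star)
open import Relation.Nullary using (¬_)

Graph : ℕ → Set₁
Graph n = Fin n → Fin n → Set

module _ {n : ℕ} where

  Bidirected : Graph n → Set
  Bidirected E = ∀ v w → E v w → E w v

  InducedEdge : Graph n → Subset n → Fin n → Fin n → Set
  InducedEdge E U v w = v ∈ U × w ∈ U × E v w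

  StronglyConnected : Graph n → Subset n → Set
  StronglyConnected E U = ∀ u w → u ∈ U → w ∈ U → Star (InducedEdge E U) u w

  -- Separator decomposition of the subgraph of E induced by the vertex set U
  -- (the whole graph is the case U = ⊤).  `leaf v` is the one-vertex case,
  -- `node X C T ...` has root node X and children the decompositions T i of the
  -- subgraphs induced by C i (i < d), which are the strongly connected pieces
  -- G_0,…,G_{d-1} into which removing X separates the graph.
  data SepDec (E : Graph n) : Subset n → Set where
    leaf : (v : Fin n) → SepDec E ⁅ v ⁆
    node : {U : Subset n} → 1 < ∣ U ∣ →
           (X : Subset n) → X ⊆ U →
           (d : ℕ) (C : Fin d → Subset n) (T : (i : Fin d) → SepDec E (C i)) →
           (∀ i x → x ∈ C i → x ∈ U × x ∉ X) →
           (∀ x → x ∈ U → x ∉ X → ∃ λ i → x ∈ C i) →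
           (∀ i j → i ≢ j → ∀ x → x ∈ C i → x ∉ C j) →
           (∀ i j → i ≢ j → ∀ x y → x ∈ C i → y ∈ C j → ¬ E x y) →
           (∀ i → StronglyConnected E (C i)) →
           SepDec E U

  module _ {E : Graph n} where

    root : ∀ {U} → SepDec E U → Subset n
    root (leaf v) = ⁅ v ⁆
    root (node _ X _ _ _ _ _ _ _ _ _) = X

    -- S ≼ T : S is a subtree T_X of T (rooted at some node X of T);
    -- if S : SepDec E W then W is the vertex set of G_X, and X = root S.
    data _≼_ : ∀ {W U} → SepDec E W → SepDec E U → Set where
      here  : ∀ {U} {T : SepDec E U} → T ≼ T
      there : ∀ {W U} {S : SepDec E W} {p X} {q : X ⊆ U} {d C T a b c e f} (i : Fin d) →
              S ≼ T i → S ≼ node {U = U} p X q d C T a b c e f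

    -- Postorder T ws : ws is a postorder walk of T, where the children of a
    -- node may be visited in any order (σ) and the vertices of a node are
    -- listed in any order (xs, a duplicate-free enumeration of X).
    data Postorder : ∀ {U} → SepDec E U → List (Fin n) → Set where
      pleaf : ∀ v → Postorder (leaf v) (v ∷ [])
      pnode : ∀ {U p X} {q : X ⊆ U} {d C T a b c e f}
              (ws : Fin d → List (Fin n)) → (∀ i → Postorder (T i) (ws i)) →
              (σ : Permutation′ d) →
              (xs : List (Fin n)) → Unique xs → (∀ x → (x ∈ X) ⇔ (x LM.∈ xs)) →
              Postorder (node {U = U} p X q d C T a b c e f)
                        (concat (tabulate (λ i → ws (σ ⟨$⟩ʳ i))) ++ xs)

  -- π is a nested dissection order induced by T: π ⟨$⟩ʳ i is the vertex
  -- numbered i, i.e. the vertices listed in order of rank form a postorder walk.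
  NestedDissectionOrder : {E : Graph n} {U : Subset n} → SepDec E U → Permutation′ n → Set
  NestedDissectionOrder T π = Postorder T (tabulate (π ⟨$⟩ʳ_))

  Rank : Permutation′ n → Fin n → ℕ
  Rank π v = toℕ (π ⟨$⟩ˡ v)

  -- Hk E π k is the current edge set (G plus all shortcuts)
  -- after the vertices of rank < k have been contracted.  In step k the
  -- vertex v of rank k is contracted: shortcuts are added between every pair
  -- of distinct neighbours a, b of v that are not yet contracted (rank > k).
  Hk : Graph n → Permutation′ n → ℕ → Graph n
  Hk E π zero a b = E a b
  Hk E π (suc k) a b =
    Hk E π k a b ⊎
    (Σ (k < n) λ k<n →
      Hk E π k (π ⟨$⟩ʳ fromℕ< k<n) a × Hk E π k (π ⟨$⟩ʳ fromℕ< k<n) b ×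
      k < Rank π a × k < Rank π b × a ≢ b)

  H : Graph n → Permutation′ n → Graph n
  H E π = Hk E π n

  data Upward (E : Graph n) (π : Permutation′ n) : Fin n → Fin n → Set where
    stop : ∀ {v} → Upward E π v v
    step : ∀ {u v w} → H E π u v → Rank π u < Rank π v → Upward E π v w → Upward E π u w

  SearchSpace : Graph n → Permutation′ n → Fin n → Fin n → Set
  SearchSpace E π v w = Upward E π v w

  Boundary : Graph n → Subset n → Fin n → Set
  Boundary E W w = w ∉ W × ∃ λ v → v ∈ W × E v w

{-# OPTIONS --safe #-}
module Submission where

-- All vertices of G_X precede the boundary B(X) in a nested dissection order,
-- and G_X is strongly connected (the whole graph is excluded because B(X) ≠ ∅).
-- Hence any two boundary vertices b, b' are joined by a path of G whose
-- interior lies in G_X and is ranked below both; contracting that interior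
-- vertex by vertex leaves the shortcut b b' in H.  So B(X) is a clique of H,
-- and S(l) contains every b ∈ B(X) together with S(b), because l has the
-- lowest rank in B(X).

open import Defs
open import Data.Nat using (ℕ; zero; suc; _+_; _≤_; _<_; _⊓_; _≤′_; ≤′-refl; ≤′-step; s≤s; z≤n)
open import Data.Nat.Properties
  using (≤⇒≤′; ≤-reflexive; ≤-trans; <⇒≤; <-irrefl; <-irrelevant; ≤∧≢⇒<;
         m<m+n; m+n≤o⇒n≤o; m<1+n⇒m<n∨m≡n; m⊓n≤m; m⊓n≤n; ⊓-pres-m<)
open import Data.Fin using (Fin; zero; suc; toℕ; fromℕ<; _≟_)
open import Data.Fin.Properties using (toℕ-injective; toℕ-fromℕ<; toℕ<n)
open import Data.Fin.Subset using (Subset; ⊤; _∈_; _⊆_)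
open import Data.Fin.Subset.Properties using (∈⊤; x∈⁅y⁆⇒x≡y; _∈?_)
open import Data.Fin.Permutation using (Permutation′; _⟨$⟩ʳ_; _⟨$⟩ˡ_; inverseˡ; inverseʳ)
open import Data.List using (List; []; _∷_; _++_; concat; tabulate; length)
open import Data.List.Properties using (++-assoc; length-++; ∷-injective)
import Data.List.Membership.Propositional as List
open import Data.List.Membership.Propositional.Properties
  using (∈-++⁺ˡ; ∈-++⁺ʳ; ∈-∃++; ∈-concat⁺′; ∈-tabulate⁺)
open import Data.List.Relation.Unary.Any using (here)
open import Data.Product using (Σ; ∃; ∃₂; _×_; _,_; proj₁; proj₂)
open import Data.Sum using (_⊎_; inj₁; inj₂)
open import Data.Empty using (⊥-elim)
open import Function.Bundles using (_⇔_; mk⇔; Equivalence)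
open import Relation.Binary.PropositionalEquality
open import Relation.Binary.Construct.Closure.ReflexiveTransitive using (Star; ε; _◅_; gmap)
open import Relation.Nullary using (yes; no)

tabulate-position : ∀ {A : Set} {d} (f : Fin d → A) P x R → tabulate f ≡ P ++ x ∷ R →
                    ∃ λ i → toℕ i ≡ length P × f i ≡ x
tabulate-position {d = suc _} f [] x R eq = zero , refl , proj₁ (∷-injective eq)
tabulate-position {d = suc _} f (_ ∷ P) x R eq
  with tabulate-position (λ i → f (suc i)) P x R (proj₂ (∷-injective eq))
... | i , i≡P , fi≡x = suc i , cong suc i≡P , fi≡x

module _ {n : ℕ} (π : Permutation′ n) where

  Rank-injective : ∀ {a b} → Rank π a ≡ Rank π b → a ≡ b
  Rank-injective {a} {b} eq = begin
    a                          ≡⟨ inverseʳ π ⟨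
    π ⟨$⟩ʳ (π ⟨$⟩ˡ a)          ≡⟨ cong (π ⟨$⟩ʳ_) (toℕ-injective eq) ⟩
    π ⟨$⟩ʳ (π ⟨$⟩ˡ b)          ≡⟨ inverseʳ π ⟩
    b                          ∎
    where open ≡-Reasoning

  Rank<n : ∀ a → Rank π a < n
  Rank<n a = toℕ<n (π ⟨$⟩ˡ a)

  vertexOfRank : ∀ k → k < n → Fin n
  vertexOfRank k k<n = π ⟨$⟩ʳ fromℕ< k<n

  Rank-vertexOfRank : ∀ k (k<n : k < n) → Rank π (vertexOfRank k k<n) ≡ k
  Rank-vertexOfRank k k<n = trans (cong toℕ (inverseˡ π)) (toℕ-fromℕ< k<n)

  Rank-position : ∀ P x R → tabulate (π ⟨$⟩ʳ_) ≡ P ++ x ∷ R → Rank π x ≡ length P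
  Rank-position P x R eq with tabulate-position (π ⟨$⟩ʳ_) P x R eq
  ... | i , i≡P , refl = trans (cong toℕ (inverseˡ π)) i≡P

Precedes : {A : Set} → List A → A → A → Set
Precedes L x y = ∃₂ λ P R → L ≡ P ++ x ∷ R × y List.∈ R

module _ {A : Set} {x y : A} where

  Precedes-++ˡ : ∀ {L} M → Precedes L x y → Precedes (L ++ M) x y
  Precedes-++ˡ M (P , R , refl , y∈R) = P , R ++ M , ++-assoc P (x ∷ R) M , ∈-++⁺ˡ y∈R

  Precedes-++ʳ : ∀ L {M} → Precedes M x y → Precedes (L ++ M) x y
  Precedes-++ʳ L (P , R , refl , y∈R) = L ++ P , R , sym (++-assoc L P (x ∷ R)) , y∈R

  Precedes-++ : ∀ {L M} → x List.∈ L → y List.∈ M → Precedes (L ++ M) x y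
  Precedes-++ {M = M} x∈L y∈M with ∈-∃++ x∈L
  ... | P , R , refl = P , R ++ M , ++-assoc P (x ∷ R) M , ∈-++⁺ʳ R y∈M

  Precedes-concat : ∀ {d} (g : Fin d → List A) j → Precedes (g j) x y →
                    Precedes (concat (tabulate g)) x y
  Precedes-concat g zero    p = Precedes-++ˡ _ p
  Precedes-concat g (suc j) p = Precedes-++ʳ (g zero) (Precedes-concat (λ i → g (suc i)) j p)

Precedes⇒Rank< : ∀ {n} (π : Permutation′ n) {x y} →
                 Precedes (tabulate (π ⟨$⟩ʳ_)) x y → Rank π x < Rank π y
Precedes⇒Rank< π {x} {y} (P , R , eq , y∈R) with ∈-∃++ y∈R
... | Q , S , refl = begin-strict
  Rank π x                     ≡⟨ Rank-position π P x _ eq ⟩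
  length P                     <⟨ m<m+n (length P) (s≤s z≤n) ⟩
  length P + suc (length Q)    ≡⟨ length-++ P ⟨
  length (P ++ x ∷ Q)          ≡⟨ Rank-position π (P ++ x ∷ Q) y S eq′ ⟨
  Rank π y                     ∎
  where
  open Data.Nat.Properties.≤-Reasoning
  eq′ : tabulate (π ⟨$⟩ʳ_) ≡ (P ++ x ∷ Q) ++ y ∷ S
  eq′ = trans eq (sym (++-assoc P (x ∷ Q) (y ∷ S)))

module _ {n : ℕ} (E : Graph n) (π : Permutation′ n) where

  Hk-sym : Bidirected E → ∀ k {a b} → Hk E π k a b → Hk E π k b a
  Hk-sym bd zero    h        = bd _ _ h
  Hk-sym bd (suc k) (inj₁ h) = inj₁ (Hk-sym bd k h)
  Hk-sym bd (suc k) (inj₂ (k<n , va , vb , ka , kb , a≢b)) =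
    inj₂ (k<n , vb , va , kb , ka , λ b≡a → a≢b (sym b≡a))

  Hk-mono : ∀ {k m} → k ≤′ m → ∀ {a b} → Hk E π k a b → Hk E π m a b
  Hk-mono ≤′-refl      h = h
  Hk-mono (≤′-step k≤m) h = inj₁ (Hk-mono k≤m h)

  data LowWalk (k : ℕ) : Fin n → Fin n → Set where
    edge : ∀ {a b} → E a b → LowWalk k a b
    cons : ∀ {a x b} → E a x → Rank π x < k → LowWalk k x b → LowWalk k a b

  LowWalk-through : ∀ {k V a x y b} → (∀ z → z ∈ V → Rank π z < k) →
                    E a x → x ∈ V → Star (InducedEdge E V) x y → E y b → LowWalk k a b
  LowWalk-through low eax x∈V ε                   eyb = cons eax (low _ x∈V) (edge eyb)
  LowWalk-through low eax x∈V ((_ , z∈V , exz) ◅ p) eyb =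
    cons eax (low _ x∈V) (LowWalk-through low exz z∈V p eyb)

  LowWalkSplit : ℕ → Fin n → Fin n → Set
  LowWalkSplit k a b = LowWalk k a b ⊎ Σ (k < n) λ k<n →
    LowWalk k a (vertexOfRank π k k<n) × LowWalk k (vertexOfRank π k k<n) b

  LowWalk-split : ∀ k {a b} → LowWalk (suc k) a b → LowWalkSplit k a b
  LowWalk-split k (edge e) = inj₁ (edge e)
  LowWalk-split k (cons {x = x} e x<1+k w) with m<1+n⇒m<n∨m≡n x<1+k | LowWalk-split k w
  ... | inj₁ x<k | inj₁ w′              = inj₁ (cons e x<k w′)
  ... | inj₁ x<k | inj₂ (k<n , w₁ , w₂) = inj₂ (k<n , cons e x<k w₁ , w₂)
  ... | inj₂ x≡k | rest                 = inj₂ (k<n , subst (LowWalk k _) x≡v (edge e) , after rest)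
    where
    k<n : k < n
    k<n = subst (_< n) x≡k (Rank<n π x)
    x≡v : x ≡ vertexOfRank π k k<n
    x≡v = Rank-injective π (trans x≡k (sym (Rank-vertexOfRank π k k<n)))
    after : ∀ {b} → LowWalkSplit k x b → LowWalk k (vertexOfRank π k k<n) b
    after (inj₁ w′)               = subst (λ z → LowWalk k z _) x≡v w′
    after (inj₂ (k<n′ , _ , w₂)) = subst (λ p → LowWalk k (vertexOfRank π k p) _) (<-irrelevant k<n′ k<n) w₂

  LowWalk⇒Hk : Bidirected E → ∀ k {a b} → LowWalk k a b →
               k ≤ Rank π a → k ≤ Rank π b → a ≢ b → Hk E π k a b
  LowWalk⇒Hk bd zero (edge e) _ _ _ = e
  LowWalk⇒Hk bd (suc k) w k<a k<b a≢b with LowWalk-split k w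
  ... | inj₁ w′ = inj₁ (LowWalk⇒Hk bd k w′ (m+n≤o⇒n≤o 1 k<a) (m+n≤o⇒n≤o 1 k<b) a≢b)
  ... | inj₂ (k<n , w₁ , w₂) =
    inj₂ (k<n , Hk-sym bd k (LowWalk⇒Hk bd k w₁ (m+n≤o⇒n≤o 1 k<a) k≤v a≢v)
              , LowWalk⇒Hk bd k w₂ k≤v (m+n≤o⇒n≤o 1 k<b) v≢b , k<a , k<b , a≢b)
    where
    v≡k = Rank-vertexOfRank π k k<n
    k≤v = ≤-reflexive (sym v≡k)
    a≢v : _ ≢ vertexOfRank π k k<n
    a≢v refl = <-irrefl (sym v≡k) k<a
    v≢b : vertexOfRank π k k<n ≢ _
    v≢b refl = <-irrefl (sym v≡k) k<b

  LowWalk⇒H : Bidirected E → ∀ {k a b} → LowWalk k a b →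
              k ≤ Rank π a → k ≤ Rank π b → a ≢ b → H E π a b
  LowWalk⇒H bd {k} {a} w k≤a k≤b a≢b =
    Hk-mono (≤⇒≤′ (≤-trans k≤a (<⇒≤ (Rank<n π a)))) (LowWalk⇒Hk bd k w k≤a k≤b a≢b)

∈-concat-permuted : ∀ {A : Set} {d} (ws : Fin d → List A) (σ : Permutation′ d) i {x} →
                    x List.∈ ws i → x List.∈ concat (tabulate (λ j → ws (σ ⟨$⟩ʳ j)))
∈-concat-permuted ws σ i x∈wsᵢ =
  ∈-concat⁺′ x∈wsᵢ (subst (λ j → ws j List.∈ tabulate (λ k → ws (σ ⟨$⟩ʳ k))) (inverseʳ σ)
                                (∈-tabulate⁺ (σ ⟨$⟩ˡ i)))

module _ {n : ℕ} {E : Graph n} where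

  StronglyConnected-resp : ∀ {U V} → U ⊆ V → V ⊆ U → StronglyConnected E U → StronglyConnected E V
  StronglyConnected-resp U⊆V V⊆U sc u w u∈V w∈V =
    gmap (λ z → z) (λ (x∈U , y∈U , e) → U⊆V x∈U , U⊆V y∈U , e) (sc u w (V⊆U u∈V) (V⊆U w∈V))

  ≼⇒⊆ : ∀ {W U} {S : SepDec E W} {T : SepDec E U} → S ≼ T → W ⊆ U
  ≼⇒⊆ here        x∈W = x∈W
  ≼⇒⊆ (there {a = pieces⊆} i S≼Tᵢ) x∈W = proj₁ (pieces⊆ i _ (≼⇒⊆ S≼Tᵢ x∈W))

  ≼⇒⊇⊎StronglyConnected : ∀ {W U} {S : SepDec E W} {T : SepDec E U} → S ≼ T →
                          U ⊆ W ⊎ StronglyConnected E W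
  ≼⇒⊇⊎StronglyConnected here = inj₁ (λ x∈U → x∈U)
  ≼⇒⊇⊎StronglyConnected (there {f = connected} i S≼Tᵢ) with ≼⇒⊇⊎StronglyConnected S≼Tᵢ
  ... | inj₁ Cᵢ⊆W = inj₂ (StronglyConnected-resp Cᵢ⊆W (≼⇒⊆ S≼Tᵢ) (connected i))
  ... | inj₂ sc   = inj₂ sc

  Postorder-∈ : ∀ {U L} {T : SepDec E U} → Postorder T L → ∀ {x} → x ∈ U → x List.∈ L
  Postorder-∈ (pleaf v) x∈⁅v⁆ = here (x∈⁅y⁆⇒x≡y v x∈⁅v⁆)
  Postorder-∈ (pnode {X = X} {b = covered} ws walks σ xs _ xs↔X) {x} x∈U with x ∈? X
  ... | yes x∈X = ∈-++⁺ʳ _ (Equivalence.to (xs↔X x) x∈X)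
  ... | no  x∉X with covered x x∈U x∉X
  ... | i , x∈Cᵢ = ∈-++⁺ˡ (∈-concat-permuted ws σ i (Postorder-∈ (walks i) x∈Cᵢ))

  Postorder-boundary : ∀ {W U L} {S : SepDec E W} {T : SepDec E U} → S ≼ T → Postorder T L →
                       ∀ {x b} → x ∈ W → b ∈ U → Boundary E W b → Precedes L x b
  Postorder-boundary here _ _ b∈U (b∉W , _) = ⊥-elim (b∉W b∈U)
  Postorder-boundary (there {X = X} {b = covered} {e = no-edge} i S≼Tᵢ) (pnode ws walks σ _ _ xs↔X)
                     {x} {b} x∈W b∈U bdry@(_ , v , v∈W , evb) with b ∈? X
  ... | yes b∈X = Precedes-++ (∈-concat-permuted ws σ i (Postorder-∈ (walks i) (≼⇒⊆ S≼Tᵢ x∈W)))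
                              (Equivalence.to (xs↔X b) b∈X)
  ... | no b∉X with covered b b∈U b∉X
  ... | j , b∈Cⱼ with j ≟ i
  ... | no j≢i = ⊥-elim (no-edge i j (λ i≡j → j≢i (sym i≡j)) v b (≼⇒⊆ S≼Tᵢ v∈W) b∈Cⱼ evb)
  ... | yes refl = Precedes-++ˡ _ (Precedes-concat (λ k → ws (σ ⟨$⟩ʳ k)) (σ ⟨$⟩ˡ i)
                     (subst (λ k → Precedes (ws k) x b) (sym (inverseʳ σ))
                       (Postorder-boundary S≼Tᵢ (walks i) x∈W b∈Cⱼ bdry)))

module _ {n : ℕ} {E : Graph n} (bd : Bidirected E) {T : SepDec E ⊤} {π : Permutation′ n}
         (nd : NestedDissectionOrder T π) {W : Subset n} {S : SepDec E W} (S≼T : S ≼ T) where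

  Rank-below-boundary : ∀ {x b} → x ∈ W → Boundary E W b → Rank π x < Rank π b
  Rank-below-boundary x∈W bdry = Precedes⇒Rank< π (Postorder-boundary S≼T nd x∈W ∈⊤ bdry)

  boundary-clique : ∀ {b b′} → Boundary E W b → Boundary E W b′ → b ≢ b′ → H E π b b′
  boundary-clique {b} {b′} bdry@(b∉W , v , v∈W , evb) bdry′@(_ , v′ , v′∈W , ev′b′) b≢b′
    with ≼⇒⊇⊎StronglyConnected S≼T
  ... | inj₁ ⊤⊆W = ⊥-elim (b∉W (⊤⊆W ∈⊤))
  ... | inj₂ sc  = LowWalk⇒H E π bd walk (m⊓n≤m _ _) (m⊓n≤n _ _) b≢b′
    where
    below : ∀ z → z ∈ W → Rank π z < Rank π b ⊓ Rank π b′
    below z z∈W = ⊓-pres-m< (Rank-below-boundary z∈W bdry) (Rank-below-boundary z∈W bdry′)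
    walk : LowWalk E π (Rank π b ⊓ Rank π b′) b b′
    walk = LowWalk-through E π below (bd v b evb) v∈W (sc v v′ v∈W v′∈W) ev′b′

theorem3 : {n : ℕ} (E : Graph n) → Bidirected E → StronglyConnected E ⊤ →
           (T : SepDec E ⊤) (π : Permutation′ n) → NestedDissectionOrder T π →
           {W : Subset n} (TX : SepDec E W) → TX ≼ T →
           (l : Fin n) → Boundary E W l →
           (∀ b → Boundary E W b → Rank π l ≤ Rank π b) →
           ∀ w → SearchSpace E π l w ⇔ (∃ λ b → Boundary E W b × SearchSpace E π b w)
theorem3 E bd _ T π nd {W} TX TX≼T l l∈B l-lowest w = mk⇔ (λ s → l , l∈B , s) from
  where
  from : (∃ λ b → Boundary E W b × SearchSpace E π b w) → SearchSpace E π l w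
  from (b , b∈B , s) with l ≟ b
  ... | yes refl = s
  ... | no l≢b   = step (boundary-clique bd nd TX≼T l∈B b∈B l≢b)
                        (≤∧≢⇒< (l-lowest b b∈B) (λ eq → l≢b (Rank-injective π eq))) s
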